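{- If $G$ is a finite simple connected graph with $\mathsf{in}_t(G)\le 2$, then $G$ is a path.
   Context: Zero-visibility $k$-search game on a finite simple graph $G$: an invisible intruder occupies a vertex; players alternate starting with the searcher; on each turn the searcher inspects an arbitrary set of $k$ vertices and wins if the intruder is at one of them; otherwise the intruder may move to an adjacent vertex or stay. The inspection number $\mathsf{in}(G)$ is the least $k$ for which the searcher has a finite sequence of moves guaranteeing capture. A subdivision of $G$ is obtained by repeatedly replacing an edge by a path of length two through a new vertex. $\mathsf{in}_t(G)$ is the least $k$ such that every subdivision $H$ of $G$ has a further subdivision $H'$ with $\mathsf{in}(H')\le k$. -}

module Defs where

open import Data.Nat using (ℕ; zero; suc; _≤_; _<_)
open import Data.Fin using (Fin; zero; suc; toℕ; _≟_)
open import Data.Fin.Subset using (Subset; _∈_; ∣_∣)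
open import Data.Bool using (Bool; true; false; _∧_; _∨_; not)
open import Data.Bool.Properties using (∨-comm; ∧-comm)
open import Data.Product using (Σ; ∃; _×_; _,_)
open import Data.Sum using (_⊎_)
open import Relation.Nullary.Decidable using (⌊_⌋)
open import Relation.Binary.PropositionalEquality using (_≡_; refl; cong₂; cong)
open import Function.Definitions using (Bijective)
import Data.Nat as ℕ

record Graph : Set where
  field
    n      : ℕ
    adj    : Fin n → Fin n → Bool
    sym    : ∀ u v → adj u v ≡ adj v u
    irrefl : ∀ v → adj v v ≡ false
open Graph public

Vertex : Graph → Set
Vertex G = Fin (n G)

-- A searcher strategy of length m is a sequence S 0, …, S (m-1) of vertex
-- sets, each of size at most k (zero visibility: it cannot adapt).

StepOrStay : (G : Graph) → Vertex G → Vertex G → Set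
StepOrStay G a b = (a ≡ b) ⊎ (adj G a b ≡ true)

IsTrajectory : (G : Graph) (m : ℕ) → (ℕ → Vertex G) → Set
IsTrajectory G m w = ∀ i → suc i < m → StepOrStay G (w i) (w (suc i))

WinningStrategy : (G : Graph) (k m : ℕ) → (ℕ → Subset (n G)) → Set
WinningStrategy G k m S =
  (∀ i → i < m → ∣ S i ∣ ≤ k) ×
  (∀ (w : ℕ → Vertex G) → IsTrajectory G m w →
     Σ ℕ λ i → (i < m) × (w i ∈ S i))

-- "in(G) ≤ k": the searcher has a finite winning strategy with k inspections
-- per turn (the game is monotone in k, so this is exactly in(G) ≤ k).
InspectionAtMost : Graph → ℕ → Set
InspectionAtMost G k = Σ ℕ λ m → Σ (ℕ → Subset (n G)) λ S → WinningStrategy G k m S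

-- Subdividing an edge uv: new vertex is zero, old vertex a becomes suc a.

module _ (G : Graph) (u v : Vertex G) where
  private
    eq : Vertex G → Vertex G → Bool
    eq a b = ⌊ a ≟ b ⌋

    isEnd : Vertex G → Bool
    isEnd b = eq b u ∨ eq b v

    isUV : Vertex G → Vertex G → Bool
    isUV a b = (eq a u ∧ eq b v) ∨ (eq a v ∧ eq b u)

    isUV-sym : ∀ a b → isUV a b ≡ isUV b a
    isUV-sym a b rewrite ∧-comm (eq a u) (eq b v) | ∧-comm (eq a v) (eq b u)
      = ∨-comm (eq b v ∧ eq a u) (eq b u ∧ eq a v)

    sadj : Fin (suc (n G)) → Fin (suc (n G)) → Bool
    sadj zero    zero    = false
    sadj zero    (suc b) = isEnd b
    sadj (suc a) zero    = isEnd a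
    sadj (suc a) (suc b) = adj G a b ∧ not (isUV a b)

    ssym : ∀ a b → sadj a b ≡ sadj b a
    ssym zero    zero    = refl
    ssym zero    (suc b) = refl
    ssym (suc a) zero    = refl
    ssym (suc a) (suc b) = cong₂ _∧_ (Graph.sym G a b) (cong not (isUV-sym a b))

    sirr : ∀ a → sadj a a ≡ false
    sirr zero = refl
    sirr (suc a) rewrite Graph.irrefl G a = refl

  subdivide : adj G u v ≡ true → Graph
  subdivide _ = record { n = suc (n G) ; adj = sadj ; sym = ssym ; irrefl = sirr }

data Subdivision (G : Graph) : Graph → Set where
  here : Subdivision G G
  step : ∀ {H} → Subdivision G H →
         (u v : Vertex H) (e : adj H u v ≡ true) → Subdivision G (subdivide H u v e)

TopInspectionAtMost : Graph → ℕ → Set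
TopInspectionAtMost G k =
  ∀ H → Subdivision G H → Σ Graph λ H' → Subdivision H H' × InspectionAtMost H' k

data Reach (G : Graph) : Vertex G → Vertex G → Set where
  reach-refl : ∀ {a} → Reach G a a
  reach-step : ∀ {a b c} → adj G a b ≡ true → Reach G b c → Reach G a c

Connected : Graph → Set
Connected G = (1 ≤ n G) × (∀ a b → Reach G a b)

pathAdj : ∀ {m} → Fin m → Fin m → Bool
pathAdj i j = ⌊ suc (toℕ i) ℕ.≟ toℕ j ⌋ ∨ ⌊ suc (toℕ j) ℕ.≟ toℕ i ⌋

IsPath : Graph → Set
IsPath G = Σ (Fin (n G) → Vertex G) λ f →
  Bijective _≡_ _≡_ f × (∀ i j → adj G (f i) (f j) ≡ pathAdj i j)

{-# OPTIONS --safe #-}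
module Submission where

-- If some vertex v has three neighbours, subdividing the three edges at v produces a
-- spider (three paths of length two with the common end v), and every further
-- subdivision still contains a spider as a subgraph. If every vertex has two
-- neighbours, every subdivision keeps minimum degree two. Otherwise G has maximum
-- degree two and a leaf, and being connected it is a path.
--
-- Both obstructions force three inspections. The vertices certainly free of the
-- intruder after a round form a cleared set, which evolves as C ↦ interior C ∪ P for
-- the inspected set P; a property of cleared sets that holds initially, is kept by
-- every inspection of two vertices and excludes the full vertex set shows that two
-- inspections never suffice. With minimum degree two the property is |C| ≤ 2, as a
-- vertex is interior only together with two neighbours. On the spider it is a bound on
-- |C| and on the boundary of C, verified by enumerating all pairs of subsets; inspection
-- numbers can only grow when passing to a supergraph.

open import Defs hiding (sym)

open import Data.Bool as Bool using (true; false; _∧_; _∨_; not)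
open import Data.Bool.Properties using (∨-comm; T-≡; T-∨; ¬-not)
open import Data.Empty using (⊥-elim)
open import Data.Fin using (Fin; zero; suc; toℕ; fromℕ<; _≟_)
open import Data.Fin.Properties
  using (suc-injective; toℕ-injective; toℕ<n; toℕ-fromℕ<; any?; all?; ¬∀⟶∃¬; injective⇒≤)
open import Data.Fin.Subset using (Subset; _∈_; _∉_; ∣_∣; ⊥; _∪_; _─_; _-_; inside; outside)
open import Data.Fin.Subset.Properties
  using ( _∈?_; anySubset?; drop-there; x∈p∧x≢y⇒x∈p-y; x∈p⇒∣p-x∣<∣p∣; p⊆q⇒∣p∣≤∣q∣
        ; x∈p∪q⁻; x∈p∪q⁺; ∣⊥∣≡0; ∣⊤∣≡n; ∈⊤)
open import Data.Nat as ℕ using (ℕ; zero; suc; _+_; _≤_; _<_; _≤?_; z≤n; s≤s)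
import Data.Nat.Properties as ℕ
open import Data.Product using (Σ; ∃; _×_; _,_; proj₁; proj₂; ∃-syntax)
open import Data.Sum using (_⊎_; inj₁; inj₂; [_,_]′)
import Data.Sum as Sum
open import Data.Vec using (_∷_; []; here; there; tabulate)
open import Data.Vec.Properties using (lookup∘tabulate; []=⇒lookup; lookup⇒[]=)
open import Function using (_∘_; id; flip)
open import Function.Bundles using (Equivalence)
open import Function.Definitions using (Injective)
open import Relation.Binary.PropositionalEquality
  using (_≡_; _≢_; refl; sym; trans; cong; cong₂; subst; subst₂)
open import Relation.Nullary using (¬_; Dec; yes; no; does; contradiction)
open import Relation.Nullary.Decidable
  using ( _×-dec_; _⊎-dec_; _→-dec_; ¬?; ⌊_⌋; toWitness; toWitnessFalse; decidable-stable
        ; dec-true; dec-false; isYes≗does)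
open import Relation.Binary.Definitions using (tri<; tri≈; tri>)
open import Relation.Unary using (Decidable)

private
  variable
    A : Set
    m t : ℕ

subsetOf : {P : Fin m → Set} → Decidable P → Subset m
subsetOf P? = tabulate (λ x → does (P? x))

module _ {P : Fin m → Set} (P? : Decidable P) {x : Fin m} where

  ∈subsetOf⁺ : P x → x ∈ subsetOf P?
  ∈subsetOf⁺ px = lookup⇒[]= x _ (trans (lookup∘tabulate _ x) (dec-true (P? x) px))

  ∈subsetOf⁻ : x ∈ subsetOf P? → P x
  ∈subsetOf⁻ x∈ = decidable-stable (P? x) λ ¬px → contradiction
    (trans (sym (dec-false (P? x) ¬px)) (trans (sym (lookup∘tabulate _ x)) ([]=⇒lookup x∈))) λ ()

distinct³⇒3≤∣p∣ : {p : Subset m} {x y z : Fin m} → x ∈ p → y ∈ p → z ∈ p →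
                  x ≢ y → x ≢ z → y ≢ z → 3 ≤ ∣ p ∣
distinct³⇒3≤∣p∣ {p = p} {x} {y} {z} x∈p y∈p z∈p x≢y x≢z y≢z = begin
  3                  ≤⟨ s≤s (s≤s (ℕ.≤-trans (s≤s z≤n) (x∈p⇒∣p-x∣<∣p∣ z∈p-x-y))) ⟩
  2 + ∣ p - x - y ∣  ≤⟨ s≤s (x∈p⇒∣p-x∣<∣p∣ y∈p-x) ⟩
  1 + ∣ p - x ∣      ≤⟨ x∈p⇒∣p-x∣<∣p∣ x∈p ⟩
  ∣ p ∣              ∎
  where
  open ℕ.≤-Reasoning
  y∈p-x = x∈p∧x≢y⇒x∈p-y y∈p (x≢y ∘ sym)
  z∈p-x-y = x∈p∧x≢y⇒x∈p-y (x∈p∧x≢y⇒x∈p-y z∈p (x≢z ∘ sym)) (y≢z ∘ sym)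

∣p∣<m⇒∃∉ : (p : Subset m) → ∣ p ∣ < m → ∃ λ x → x ∉ p
∣p∣<m⇒∃∉ (outside ∷ p) _       = zero , λ ()
∣p∣<m⇒∃∉ (inside  ∷ p) (s≤s h) = let x , x∉p = ∣p∣<m⇒∃∉ p h in suc x , x∉p ∘ drop-there

injection⇒∣p∣≤∣q∣ : ∀ {n} {f : Fin m → Fin n} → Injective _≡_ _≡_ f →
                    (p : Subset m) {q : Subset n} → (∀ {x} → x ∈ p → f x ∈ q) → ∣ p ∣ ≤ ∣ q ∣
injection⇒∣p∣≤∣q∣ inj [] _ = z≤n
injection⇒∣p∣≤∣q∣ inj (outside ∷ p) f[p]⊆q =
  injection⇒∣p∣≤∣q∣ (suc-injective ∘ inj) p (f[p]⊆q ∘ there)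
injection⇒∣p∣≤∣q∣ {f = f} inj (inside ∷ p) {q} f[p]⊆q = begin-strict
  ∣ p ∣            ≤⟨ injection⇒∣p∣≤∣q∣ (suc-injective ∘ inj) p f[p]⊆q-f0 ⟩
  ∣ q - f zero ∣   <⟨ x∈p⇒∣p-x∣<∣p∣ (f[p]⊆q here) ⟩
  ∣ q ∣            ∎
  where
  open ℕ.≤-Reasoning
  f[p]⊆q-f0 : ∀ {x} → x ∈ p → f (suc x) ∈ q - f zero
  f[p]⊆q-f0 x∈p = x∈p∧x≢y⇒x∈p-y (f[p]⊆q (there x∈p)) λ eq → contradiction (inj eq) λ ()

extend : (ℕ → A) → ℕ → A → ℕ → A
extend w zero    x zero    = w zero
extend w zero    x (suc i) = x
extend w (suc t) x zero    = w zero
extend w (suc t) x (suc i) = extend (w ∘ suc) t x i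

extend-< : ∀ (w : ℕ → A) {t} x {i} → i < suc t → extend w t x i ≡ w i
extend-< w {zero}  x {zero}  _          = refl
extend-< w {zero}  x {suc i} (s≤s ())
extend-< w {suc t} x {zero}  _          = refl
extend-< w {suc t} x {suc i} (s≤s i<st) = extend-< (w ∘ suc) x i<st

extend-suc : ∀ (w : ℕ → A) t x → extend w t x (suc t) ≡ x
extend-suc w zero    x = refl
extend-suc w (suc t) x = extend-suc (w ∘ suc) t x

Consecutive : (A → A → Set) → ℕ → (ℕ → A) → Set
Consecutive R m w = ∀ i → suc i < m → R (w i) (w (suc i))

Distinct : ℕ → (ℕ → A) → Set
Distinct m w = ∀ {k l} → k < m → l < m → w k ≡ w l → k ≡ l

module _ (w : ℕ → A) (x : A) where

  extend-pointwise : (P : ℕ → A → Set) → (∀ i → i < suc t → P i (w i)) → P (suc t) x →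
                     ∀ i → i < suc (suc t) → P i (extend w t x i)
  extend-pointwise {t} P Pw Px i i<2+t with ℕ.m<1+n⇒m<n∨m≡n i<2+t
  ... | inj₁ i<1+t = subst (P i) (sym (extend-< w x i<1+t)) (Pw i i<1+t)
  ... | inj₂ refl  = subst (P (suc t)) (sym (extend-suc w t x)) Px

  extend-consecutive : (R : A → A → Set) → Consecutive R (suc t) w → R (w t) x →
                       Consecutive R (suc (suc t)) (extend w t x)
  extend-consecutive {t} R Rw Rx i 1+i<2+t with ℕ.m<1+n⇒m<n∨m≡n 1+i<2+t
  ... | inj₁ 1+i<1+t = subst₂ R (sym (extend-< w x (ℕ.<-trans (ℕ.n<1+n i) 1+i<1+t)))
                                (sym (extend-< w x 1+i<1+t)) (Rw i 1+i<1+t)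
  ... | inj₂ refl    = subst₂ R (sym (extend-< w x (ℕ.n<1+n t))) (sym (extend-suc w t x)) Rx

  extend-distinct : Distinct (suc t) w → (∀ {k} → k < suc t → w k ≢ x) →
                    Distinct (suc (suc t)) (extend w t x)
  extend-distinct {t} dw fresh {k} {l} k< l< eq
    with ℕ.m<1+n⇒m<n∨m≡n k< | ℕ.m<1+n⇒m<n∨m≡n l<
  ... | inj₁ k<1+t | inj₁ l<1+t =
    dw k<1+t l<1+t (trans (sym (extend-< w x k<1+t)) (trans eq (extend-< w x l<1+t)))
  ... | inj₁ k<1+t | inj₂ refl =
    contradiction (trans (sym (extend-< w x k<1+t)) (trans eq (extend-suc w t x))) (fresh k<1+t)
  ... | inj₂ refl  | inj₁ l<1+t =
    contradiction (trans (sym (extend-< w x l<1+t)) (trans (sym eq) (extend-suc w t x))) (fresh l<1+t)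
  ... | inj₂ refl  | inj₂ refl = refl

module _ (K : Graph) {x y : Vertex K} where

  adj⇒≢ : adj K x y ≡ true → x ≢ y
  adj⇒≢ xy refl = contradiction (trans (sym xy) (irrefl K x)) λ ()

  adj-sym : adj K x y ≡ true → adj K y x ≡ true
  adj-sym xy = trans (Graph.sym K y x) xy

stepOrStay? : (K : Graph) → ∀ x y → Dec (StepOrStay K x y)
stepOrStay? K x y = (x ≟ y) ⊎-dec (adj K x y Bool.≟ true)

TwoNeighbours : (K : Graph) → Vertex K → Set
TwoNeighbours K x = ∃[ y ] ∃[ z ] adj K x y ≡ true × adj K x z ≡ true × y ≢ z

twoNeighbours? : (K : Graph) → Decidable (TwoNeighbours K)
twoNeighbours? K x = any? λ y → any? λ z →
  (adj K x y Bool.≟ true) ×-dec (adj K x z Bool.≟ true) ×-dec ¬? (y ≟ z)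

ThreeNeighbours : (K : Graph) → Vertex K → Set
ThreeNeighbours K x = ∃[ a ] ∃[ b ] ∃[ c ]
  adj K x a ≡ true × adj K x b ≡ true × adj K x c ≡ true × a ≢ b × a ≢ c × b ≢ c

threeNeighbours? : (K : Graph) → Decidable (ThreeNeighbours K)
threeNeighbours? K x = any? λ a → any? λ b → any? λ c →
  (adj K x a Bool.≟ true) ×-dec (adj K x b Bool.≟ true) ×-dec (adj K x c Bool.≟ true) ×-dec
  ¬? (a ≟ b) ×-dec ¬? (a ≟ c) ×-dec ¬? (b ≟ c)

MinDegree≥2 : Graph → Set
MinDegree≥2 K = ∀ x → TwoNeighbours K x

-- Cleared sets

module ClearedSets (K : Graph) where

  interior? : (C : Subset (n K)) → Decidable λ x → ∀ y → StepOrStay K y x → y ∈ C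
  interior? C x = all? λ y → stepOrStay? K y x →-dec y ∈? C

  interior : Subset (n K) → Subset (n K)
  interior C = subsetOf (interior? C)

  module _ {C : Subset (n K)} {x : Vertex K} where

    ∈interior⇒ : x ∈ interior C → ∀ {y} → StepOrStay K y x → y ∈ C
    ∈interior⇒ x∈ {y} = ∈subsetOf⁻ (interior? C) x∈ y

    ∉interior⇒ : x ∉ interior C → ∃ λ y → StepOrStay K y x × y ∉ C
    ∉interior⇒ x∉ with ¬∀⟶∃¬ _ _ (λ y → stepOrStay? K y x →-dec y ∈? C)
                                     (x∉ ∘ ∈subsetOf⁺ (interior? C))
    ... | y , ¬[yx⇒y∈C] with stepOrStay? K y x
    ...   | yes yx = y , yx , λ y∈C → ¬[yx⇒y∈C] λ _ → y∈C
    ...   | no ¬yx = contradiction (λ yx → contradiction yx ¬yx) ¬[yx⇒y∈C]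

  -- cleared (suc t) holds the vertices that cannot hide the intruder once round t is inspected.
  module Play (S : ℕ → Subset (n K)) where

    cleared : ℕ → Subset (n K)
    cleared zero    = ⊥
    cleared (suc t) = interior (cleared t) ∪ S t

    record Escape (t : ℕ) (x : Vertex K) : Set where
      field
        path    : ℕ → Vertex K
        valid   : IsTrajectory K (suc t) path
        unseen  : ∀ i → i < suc t → path i ∉ S i
        reaches : path t ≡ x

    escape : ∀ t x → x ∉ cleared (suc t) → Escape t x
    escape zero x x∉ = record
      { path    = λ _ → x
      ; valid   = λ _ → λ { (s≤s ()) }
      ; unseen  = λ { zero _ → x∉ ∘ x∈p∪q⁺ ∘ inj₂ ; (suc _) (s≤s ()) }
      ; reaches = refl
      }
    escape (suc t) x x∉ =
      let y , yx , y∉ = ∉interior⇒ (x∉ ∘ x∈p∪q⁺ ∘ inj₁)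
          open Escape (escape t y y∉)
      in record
      { path    = extend path t x
      ; valid   = extend-consecutive path x (StepOrStay K) valid
                    (subst (λ z → StepOrStay K z x) (sym reaches) yx)
      ; unseen  = extend-pointwise path x (λ i z → z ∉ S i) unseen (x∉ ∘ x∈p∪q⁺ ∘ inj₂)
      ; reaches = extend-suc path t x
      }

  invariant⇒¬InspectionAtMost :
    ∀ {k} (Inv : Subset (n K) → Set) → Inv ⊥ →
    (∀ {C P} → Inv C → ∣ P ∣ ≤ k → Inv (interior C ∪ P)) →
    (∀ {C} → Inv C → ∃ λ x → x ∉ C) →
    ¬ InspectionAtMost K k
  invariant⇒¬InspectionAtMost Inv inv-⊥ inv-step inv-proper (zero , S , _ , win)
    with win (λ _ → proj₁ (inv-proper inv-⊥)) (λ _ ())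
  ... | _ , () , _
  invariant⇒¬InspectionAtMost Inv inv-⊥ inv-step inv-proper (suc t , S , small , win) =
    let x , x∉ = inv-proper (inv-cleared (suc t) ℕ.≤-refl)
        open Escape (escape t x x∉)
        i , i<1+t , hit = win path valid
    in unseen i i<1+t hit
    where
    open Play S
    inv-cleared : ∀ s → s ≤ suc t → Inv (cleared s)
    inv-cleared zero    _   = inv-⊥
    inv-cleared (suc s) s<m = inv-step (inv-cleared s (ℕ.<⇒≤ s<m)) (small s s<m)

record Embedding (T K : Graph) : Set where
  field
    map       : Vertex T → Vertex K
    injective : Injective _≡_ _≡_ map
    adj-map   : ∀ {s t} → adj T s t ≡ true → adj K (map s) (map t) ≡ true

InspectionAtMost-embedding : ∀ {T K k} → Embedding T K → InspectionAtMost K k → InspectionAtMost T k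
InspectionAtMost-embedding {T} {K} {k} φ (m , S , small , win) = m , S′ , small′ , win′
  where
  open Embedding φ
  inS? : ∀ i → Decidable λ s → map s ∈ S i
  inS? i s = map s ∈? S i
  S′ : ℕ → Subset (n T)
  S′ i = subsetOf (inS? i)
  small′ : ∀ i → i < m → ∣ S′ i ∣ ≤ k
  small′ i i<m = ℕ.≤-trans (injection⇒∣p∣≤∣q∣ injective (S′ i) (∈subsetOf⁻ (inS? i))) (small i i<m)
  map-step : ∀ {s t} → StepOrStay T s t → StepOrStay K (map s) (map t)
  map-step = Sum.map (cong map) adj-map
  win′ : ∀ w → IsTrajectory T m w → Σ ℕ λ i → i < m × w i ∈ S′ i
  win′ w valid = let i , i<m , hit = win (map ∘ w) (λ i → map-step ∘ valid i) in
    i , i<m , ∈subsetOf⁺ (inS? i) hit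

-- Minimum degree two

minDegree≥2⇒¬InspectionAtMost2 : ∀ K → Vertex K → MinDegree≥2 K → ¬ InspectionAtMost K 2
minDegree≥2⇒¬InspectionAtMost2 K x₀ δ =
  invariant⇒¬InspectionAtMost (λ C → ∣ C ∣ ≤ 2) (subst (_≤ 2) (sym (∣⊥∣≡0 (n K))) z≤n)
    (λ {C} {P} → invariant-step {C} {P}) (λ {C} → proper {C})
  where
  open ClearedSets K

  3≤n : 3 ≤ n K
  3≤n = let y , z , x₀y , x₀z , y≢z = δ x₀ in
    subst (3 ≤_) (∣⊤∣≡n (n K)) (distinct³⇒3≤∣p∣ ∈⊤ ∈⊤ ∈⊤ (adj⇒≢ K x₀y) (adj⇒≢ K x₀z) y≢z)

  interior-empty : ∀ {C x} → ∣ C ∣ ≤ 2 → x ∉ interior C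
  interior-empty {C} {x} ∣C∣≤2 x∈ = contradiction (ℕ.≤-trans 3≤∣C∣ ∣C∣≤2) λ { (s≤s (s≤s ())) }
    where
    y∈C = ∈interior⇒ x∈
    3≤∣C∣ = let y , z , xy , xz , y≢z = δ x in
      distinct³⇒3≤∣p∣ (y∈C (inj₁ refl)) (y∈C (inj₂ (adj-sym K xy))) (y∈C (inj₂ (adj-sym K xz)))
                     (adj⇒≢ K xy) (adj⇒≢ K xz) y≢z

  invariant-step : ∀ {C P} → ∣ C ∣ ≤ 2 → ∣ P ∣ ≤ 2 → ∣ interior C ∪ P ∣ ≤ 2
  invariant-step {C} {P} ∣C∣≤2 ∣P∣≤2 = ℕ.≤-trans (p⊆q⇒∣p∣≤∣q∣ interior-C∪P⊆P) ∣P∣≤2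
    where
    interior-C∪P⊆P : ∀ {x} → x ∈ interior C ∪ P → x ∈ P
    interior-C∪P⊆P x∈ =
      [ (λ x∈i → ⊥-elim (interior-empty ∣C∣≤2 x∈i)) , id ]′ (x∈p∪q⁻ (interior C) P x∈)

  proper : ∀ {C} → ∣ C ∣ ≤ 2 → ∃ λ x → x ∉ C
  proper {C} ∣C∣≤2 = ∣p∣<m⇒∃∉ C (ℕ.≤-trans (s≤s ∣C∣≤2) 3≤n)

-- The spider: three paths of length two with a common end

parent : Fin 7 → Fin 7
parent zero                                   = zero
parent (suc zero)                             = zero
parent (suc (suc zero))                       = suc zero
parent (suc (suc (suc zero)))                 = zero
parent (suc (suc (suc (suc zero))))           = suc (suc (suc zero))
parent (suc (suc (suc (suc (suc zero)))))     = zero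
parent (suc (suc (suc (suc (suc (suc zero)))))) = suc (suc (suc (suc (suc zero))))

IsChild : Fin 7 → Fin 7 → Set
IsChild s t = t ≢ zero × parent t ≡ s

isChild? : ∀ s t → Dec (IsChild s t)
isChild? s t = ¬? (t ≟ zero) ×-dec (parent t ≟ s)

spiderAdj : Fin 7 → Fin 7 → Bool.Bool
spiderAdj s t = ⌊ isChild? s t ⌋ ∨ ⌊ isChild? t s ⌋

spiderAdj-irrefl : ∀ s → spiderAdj s s ≡ false
spiderAdj-irrefl zero                                       = refl
spiderAdj-irrefl (suc zero)                                 = refl
spiderAdj-irrefl (suc (suc zero))                           = refl
spiderAdj-irrefl (suc (suc (suc zero)))                     = refl
spiderAdj-irrefl (suc (suc (suc (suc zero))))               = refl
spiderAdj-irrefl (suc (suc (suc (suc (suc zero)))))         = refl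
spiderAdj-irrefl (suc (suc (suc (suc (suc (suc zero)))))) = refl

spider : Graph
spider = record
  { n      = 7
  ; adj    = spiderAdj
  ; sym    = λ s t → ∨-comm ⌊ isChild? s t ⌋ ⌊ isChild? t s ⌋
  ; irrefl = spiderAdj-irrefl
  }

spiderAdj⇒ : ∀ {s t} → spiderAdj s t ≡ true → IsChild s t ⊎ IsChild t s
spiderAdj⇒ {s} {t} st = Sum.map (toWitness {a? = isChild? s t}) (toWitness {a? = isChild? t s})
  (Equivalence.to T-∨ (Equivalence.from T-≡ st))

module _ where
  open ClearedSets spider

  -- At most four spider vertices are ever cleared, and when four are, at least two of
  -- them lie on the boundary, so the intruder's next move recontaminates them.
  SpiderInvariant : Subset 7 → Set
  SpiderInvariant R = ∣ R ∣ ≤ 4 × (∣ R ∣ ≤ 3 ⊎ 2 ≤ ∣ R ─ interior R ∣)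

  spiderInvariant? : Decidable SpiderInvariant
  spiderInvariant? R = (∣ R ∣ ≤? 4) ×-dec ((∣ R ∣ ≤? 3) ⊎-dec (2 ≤? ∣ R ─ interior R ∣))

  spiderInvariant-step : ∀ {R P} → SpiderInvariant R → ∣ P ∣ ≤ 2 → SpiderInvariant (interior R ∪ P)
  spiderInvariant-step {R} {P} inv ∣P∣≤2 =
    decidable-stable (spiderInvariant? (interior R ∪ P)) λ ¬inv →
      noCounterexample (R , P , inv , ∣P∣≤2 , ¬inv)
    where
    noCounterexample : ¬ (∃[ R ] ∃[ P ]
      SpiderInvariant R × ∣ P ∣ ≤ 2 × ¬ SpiderInvariant (interior R ∪ P))
    noCounterexample = toWitnessFalse {a? = anySubset? λ R → anySubset? λ P →
      spiderInvariant? R ×-dec (∣ P ∣ ≤? 2) ×-dec ¬? (spiderInvariant? (interior R ∪ P))} _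

  spider-¬InspectionAtMost2 : ¬ InspectionAtMost spider 2
  spider-¬InspectionAtMost2 = invariant⇒¬InspectionAtMost SpiderInvariant (z≤n , inj₁ z≤n)
    (λ {R} {P} → spiderInvariant-step {R} {P})
    λ {R} (∣R∣≤4 , _) → ∣p∣<m⇒∃∉ R (ℕ.≤-<-trans ∣R∣≤4 (ℕ.m<m+n 4 (s≤s z≤n)))

-- legOf certifies that the three legs are pairwise disjoint.
record Spider (K : Graph) : Set where
  field
    centre       : Vertex K
    inner outer  : Fin 3 → Vertex K
    legOf        : Vertex K → Fin 3
    centre–inner : ∀ i → adj K centre (inner i) ≡ true
    inner–outer  : ∀ i → adj K (inner i) (outer i) ≡ true
    legOf-inner  : ∀ i → legOf (inner i) ≡ i
    legOf-outer  : ∀ i → legOf (outer i) ≡ i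
    centre≢outer : ∀ i → centre ≢ outer i

  centre≢inner : ∀ i → centre ≢ inner i
  centre≢inner i = adj⇒≢ K (centre–inner i)

  inner≢outer : ∀ i → inner i ≢ outer i
  inner≢outer i = adj⇒≢ K (inner–outer i)

innerIndex outerIndex : Fin 3 → Fin 7
innerIndex zero             = suc zero
innerIndex (suc zero)       = suc (suc (suc zero))
innerIndex (suc (suc zero)) = suc (suc (suc (suc (suc zero))))
outerIndex zero             = suc (suc zero)
outerIndex (suc zero)       = suc (suc (suc (suc zero)))
outerIndex (suc (suc zero)) = suc (suc (suc (suc (suc (suc zero)))))

module _ {K : Graph} (sp : Spider K) where
  open Spider sp

  spiderMap : Fin 7 → Vertex K
  spiderMap zero                                     = centre
  spiderMap (suc zero)                               = inner zero
  spiderMap (suc (suc zero))                         = outer zero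
  spiderMap (suc (suc (suc zero)))                   = inner (suc zero)
  spiderMap (suc (suc (suc (suc zero))))             = outer (suc zero)
  spiderMap (suc (suc (suc (suc (suc zero)))))       = inner (suc (suc zero))
  spiderMap (suc (suc (suc (suc (suc (suc zero)))))) = outer (suc (suc zero))

  spiderIndex : Vertex K → Fin 7
  spiderIndex x with x ≟ centre | x ≟ inner (legOf x)
  ... | yes _ | _     = zero
  ... | no _  | yes _ = innerIndex (legOf x)
  ... | no _  | no _  = outerIndex (legOf x)

  spiderIndex-centre : spiderIndex centre ≡ zero
  spiderIndex-centre with centre ≟ centre
  ... | yes _ = refl
  ... | no c≢c = contradiction refl c≢c

  spiderIndex-inner : ∀ i → spiderIndex (inner i) ≡ innerIndex i
  spiderIndex-inner i with inner i ≟ centre | inner i ≟ inner (legOf (inner i))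
  ... | yes i≡c | _     = contradiction (sym i≡c) (centre≢inner i)
  ... | no _    | yes _ = cong innerIndex (legOf-inner i)
  ... | no _    | no ne = contradiction (cong inner (sym (legOf-inner i))) ne

  spiderIndex-outer : ∀ i → spiderIndex (outer i) ≡ outerIndex i
  spiderIndex-outer i with outer i ≟ centre | outer i ≟ inner (legOf (outer i))
  ... | yes o≡c | _     = contradiction (sym o≡c) (centre≢outer i)
  ... | no _    | yes o≡i = contradiction (sym (trans o≡i (cong inner (legOf-outer i)))) (inner≢outer i)
  ... | no _    | no _  = cong outerIndex (legOf-outer i)

  spiderIndex-spiderMap : ∀ s → spiderIndex (spiderMap s) ≡ s
  spiderIndex-spiderMap zero                                     = spiderIndex-centre
  spiderIndex-spiderMap (suc zero)                               = spiderIndex-inner zero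
  spiderIndex-spiderMap (suc (suc zero))                         = spiderIndex-outer zero
  spiderIndex-spiderMap (suc (suc (suc zero)))                   = spiderIndex-inner (suc zero)
  spiderIndex-spiderMap (suc (suc (suc (suc zero))))             = spiderIndex-outer (suc zero)
  spiderIndex-spiderMap (suc (suc (suc (suc (suc zero)))))       = spiderIndex-inner (suc (suc zero))
  spiderIndex-spiderMap (suc (suc (suc (suc (suc (suc zero)))))) = spiderIndex-outer (suc (suc zero))

  spiderMap-parent : ∀ t → t ≢ zero → adj K (spiderMap (parent t)) (spiderMap t) ≡ true
  spiderMap-parent zero                                     t≢0 = contradiction refl t≢0
  spiderMap-parent (suc zero)                               _ = centre–inner zero
  spiderMap-parent (suc (suc zero))                         _ = inner–outer zero
  spiderMap-parent (suc (suc (suc zero)))                   _ = centre–inner (suc zero)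
  spiderMap-parent (suc (suc (suc (suc zero))))             _ = inner–outer (suc zero)
  spiderMap-parent (suc (suc (suc (suc (suc zero)))))       _ = centre–inner (suc (suc zero))
  spiderMap-parent (suc (suc (suc (suc (suc (suc zero)))))) _ = inner–outer (suc (suc zero))

  spider-embedding : Embedding spider K
  spider-embedding = record
    { map       = spiderMap
    ; injective = λ {s} {t} eq →
        trans (sym (spiderIndex-spiderMap s)) (trans (cong spiderIndex eq) (spiderIndex-spiderMap t))
    ; adj-map   = λ {s} {t} st → [ child , adj-sym K ∘ child ]′ (spiderAdj⇒ {s} {t} st)
    }
    where
    child : ∀ {s t} → IsChild s t → adj K (spiderMap s) (spiderMap t) ≡ true
    child {t = t} (t≢0 , refl) = spiderMap-parent t t≢0

spider⇒¬InspectionAtMost2 : ∀ {K} → Spider K → ¬ InspectionAtMost K 2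
spider⇒¬InspectionAtMost2 sp = spider-¬InspectionAtMost2 ∘ InspectionAtMost-embedding (spider-embedding sp)

-- Subdivisions

module SubdivisionOf (K : Graph) (u w : Vertex K) (uw : adj K u w ≡ true) where

  K′ : Graph
  K′ = subdivide K u w uw

  IsEnd : Vertex K → Set
  IsEnd x = x ≡ u ⊎ x ≡ w

  Subdivided : Vertex K → Vertex K → Set
  Subdivided x y = (x ≡ u × y ≡ w) ⊎ (x ≡ w × y ≡ u)

  subdivided? : ∀ x y → Dec (Subdivided x y)
  subdivided? x y = ((x ≟ u) ×-dec (y ≟ w)) ⊎-dec ((x ≟ w) ×-dec (y ≟ u))

  subdivided⇒end₁ : ∀ {x y} → Subdivided x y → IsEnd x
  subdivided⇒end₁ = Sum.map proj₁ proj₁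

  subdivided⇒end₂ : ∀ {x y} → Subdivided x y → IsEnd y
  subdivided⇒end₂ (inj₁ (_ , y≡w)) = inj₂ y≡w
  subdivided⇒end₂ (inj₂ (_ , y≡u)) = inj₁ y≡u

  subdivided-functional : ∀ {x y z} → Subdivided x y → Subdivided x z → y ≡ z
  subdivided-functional (inj₁ (_ , y≡w))   (inj₁ (_ , z≡w))   = trans y≡w (sym z≡w)
  subdivided-functional (inj₁ (x≡u , y≡w)) (inj₂ (x≡w , z≡u)) =
    trans y≡w (trans (sym x≡w) (trans x≡u (sym z≡u)))
  subdivided-functional (inj₂ (x≡w , y≡u)) (inj₁ (x≡u , z≡w)) =
    trans y≡u (trans (sym x≡u) (trans x≡w (sym z≡w)))
  subdivided-functional (inj₂ (_ , y≡u))   (inj₂ (_ , z≡u))   = trans y≡u (sym z≡u)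

  new–end : ∀ {x} → IsEnd x → adj K′ zero (suc x) ≡ true
  new–end {x} x-end = trans (cong₂ _∨_ (isYes≗does (x ≟ u)) (isYes≗does (x ≟ w)))
                             (dec-true ((x ≟ u) ⊎-dec (x ≟ w)) x-end)

  end–new : ∀ {x} → IsEnd x → adj K′ (suc x) zero ≡ true
  end–new = new–end

  old–old : ∀ {x y} → adj K x y ≡ true → ¬ Subdivided x y → adj K′ (suc x) (suc y) ≡ true
  old–old {x} {y} xy ¬xy = cong₂ (λ a s → a ∧ not s) xy (trans uv≡ (dec-false (subdivided? x y) ¬xy))
    where
    uv≡ : ((⌊ x ≟ u ⌋ ∧ ⌊ y ≟ w ⌋) ∨ (⌊ x ≟ w ⌋ ∧ ⌊ y ≟ u ⌋)) ≡ does (subdivided? x y)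
    uv≡ = cong₂ _∨_ (cong₂ _∧_ (isYes≗does (x ≟ u)) (isYes≗does (y ≟ w)))
                    (cong₂ _∧_ (isYes≗does (x ≟ w)) (isYes≗does (y ≟ u)))

  ¬end⇒¬subdivided₁ : ∀ {x y} → ¬ IsEnd x → ¬ Subdivided x y
  ¬end⇒¬subdivided₁ ¬end = ¬end ∘ subdivided⇒end₁

  ¬end⇒¬subdivided₂ : ∀ {x y} → ¬ IsEnd y → ¬ Subdivided x y
  ¬end⇒¬subdivided₂ ¬end = ¬end ∘ subdivided⇒end₂

  liftNeighbour : ∀ {x y} → adj K x y ≡ true →
                  ∃ λ y′ → adj K′ (suc x) y′ ≡ true × (y′ ≡ zero × Subdivided x y ⊎ y′ ≡ suc y)
  liftNeighbour {x} {y} xy with subdivided? x y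
  ... | yes s  = zero , end–new (subdivided⇒end₁ s) , inj₁ (refl , s)
  ... | no ¬s  = suc y , old–old xy ¬s , inj₂ refl

  minDegree≥2 : MinDegree≥2 K → MinDegree≥2 K′
  minDegree≥2 δ zero    =
    suc u , suc w , new–end (inj₁ refl) , new–end (inj₂ refl) , adj⇒≢ K uw ∘ suc-injective
  minDegree≥2 δ (suc x) =
    let y , z , xy , xz , y≢z = δ x
        y′ , xy′ , y′-is = liftNeighbour xy
        z′ , xz′ , z′-is = liftNeighbour xz
    in y′ , z′ , xy′ , xz′ , lifts-distinct y≢z y′-is z′-is
    where
    lifts-distinct : ∀ {y z y′ z′} → y ≢ z →
      (y′ ≡ zero × Subdivided x y ⊎ y′ ≡ suc y) →
      (z′ ≡ zero × Subdivided x z ⊎ z′ ≡ suc z) → y′ ≢ z′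
    lifts-distinct y≢z (inj₁ (refl , xy)) (inj₁ (refl , xz)) _ = y≢z (subdivided-functional xy xz)
    lifts-distinct y≢z (inj₁ (refl , _))  (inj₂ refl)         ()
    lifts-distinct y≢z (inj₂ refl)        (inj₁ (refl , _))   ()
    lifts-distinct y≢z (inj₂ refl)        (inj₂ refl)         eq = y≢z (suc-injective eq)

  module _ (sp : Spider K) where
    open Spider sp

    legOf′ : Vertex K′ → Fin 3
    legOf′ zero with u ≟ centre
    ... | yes _ = legOf w
    ... | no _  = legOf u
    legOf′ (suc x) = legOf x

    legOf′-new-inner : ∀ {a} → Subdivided centre a → centre ≢ a → legOf′ zero ≡ legOf a
    legOf′-new-inner s c≢a with u ≟ centre | s
    ... | yes _   | inj₁ (_ , a≡w)   = cong legOf (sym a≡w)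
    ... | no u≢c  | inj₁ (c≡u , _)   = contradiction (sym c≡u) u≢c
    ... | yes u≡c | inj₂ (_ , a≡u)   = contradiction (sym (trans a≡u u≡c)) c≢a
    ... | no _    | inj₂ (_ , a≡u)   = cong legOf (sym a≡u)

    legOf′-new-outer : ∀ {a b i} → Subdivided a b → centre ≢ a → centre ≢ b →
                       legOf a ≡ i → legOf b ≡ i → legOf′ zero ≡ i
    legOf′-new-outer s c≢a c≢b la lb with u ≟ centre | s
    ... | yes u≡c | inj₁ (a≡u , _) = contradiction (sym (trans a≡u u≡c)) c≢a
    ... | yes u≡c | inj₂ (_ , b≡u) = contradiction (sym (trans b≡u u≡c)) c≢b
    ... | no _    | inj₁ (a≡u , _) = trans (cong legOf (sym a≡u)) la
    ... | no _    | inj₂ (_ , b≡u) = trans (cong legOf (sym b≡u)) lb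

    record LiftedLeg (i : Fin 3) : Set where
      field
        inner′        : Vertex K′
        outer′        : Vertex K′
        centre–inner′ : adj K′ (suc centre) inner′ ≡ true
        inner–outer′  : adj K′ inner′ outer′ ≡ true
        legOf-inner′  : legOf′ inner′ ≡ i
        legOf-outer′  : legOf′ outer′ ≡ i
        centre≢outer′ : suc centre ≢ outer′

    -- A leg through the subdivided edge drops its old outer vertex and so keeps length two.
    liftLeg : ∀ i → LiftedLeg i
    liftLeg i with subdivided? centre (inner i) | subdivided? (inner i) (outer i)
    ... | yes s | _ = record
      { inner′        = zero
      ; outer′        = suc (inner i)
      ; centre–inner′ = end–new (subdivided⇒end₁ s)
      ; inner–outer′  = new–end (subdivided⇒end₂ s)
      ; legOf-inner′  = trans (legOf′-new-inner s (centre≢inner i)) (legOf-inner i)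
      ; legOf-outer′  = legOf-inner i
      ; centre≢outer′ = centre≢inner i ∘ suc-injective
      }
    ... | no ¬s | yes s = record
      { inner′        = suc (inner i)
      ; outer′        = zero
      ; centre–inner′ = old–old (centre–inner i) ¬s
      ; inner–outer′  = end–new (subdivided⇒end₁ s)
      ; legOf-inner′  = legOf-inner i
      ; legOf-outer′  = legOf′-new-outer s (centre≢inner i) (centre≢outer i) (legOf-inner i) (legOf-outer i)
      ; centre≢outer′ = λ ()
      }
    ... | no ¬s | no ¬s′ = record
      { inner′        = suc (inner i)
      ; outer′        = suc (outer i)
      ; centre–inner′ = old–old (centre–inner i) ¬s
      ; inner–outer′  = old–old (inner–outer i) ¬s′
      ; legOf-inner′  = legOf-inner i
      ; legOf-outer′  = legOf-outer i
      ; centre≢outer′ = centre≢outer i ∘ suc-injective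
      }

    liftSpider : Spider K′
    liftSpider = record
      { centre       = suc centre
      ; inner        = LiftedLeg.inner′ ∘ liftLeg
      ; outer        = LiftedLeg.outer′ ∘ liftLeg
      ; legOf        = legOf′
      ; centre–inner = LiftedLeg.centre–inner′ ∘ liftLeg
      ; inner–outer  = LiftedLeg.inner–outer′ ∘ liftLeg
      ; legOf-inner  = LiftedLeg.legOf-inner′ ∘ liftLeg
      ; legOf-outer  = LiftedLeg.legOf-outer′ ∘ liftLeg
      ; centre≢outer = LiftedLeg.centre≢outer′ ∘ liftLeg
      }

subdivision-preserves : (P : Graph → Set) →
  (∀ {K u w} (uw : adj K u w ≡ true) → P K → P (subdivide K u w uw)) →
  ∀ {H H′} → Subdivision H H′ → P H → P H′
subdivision-preserves P lift here       p = p
subdivision-preserves P lift (step s u w uw) p = lift uw (subdivision-preserves P lift s p)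

-- Spiders at vertices of degree three

module _ {G : Graph} {v a b c : Vertex G}
         (va : adj G v a ≡ true) (vb : adj G v b ≡ true) (vc : adj G v c ≡ true)
         (a≢b : a ≢ b) (a≢c : a ≢ c) (b≢c : b ≢ c) where

  private
    module S₁ = SubdivisionOf G v a va

    v₁b : adj S₁.K′ (suc v) (suc b) ≡ true
    v₁b = S₁.old–old vb (S₁.¬end⇒¬subdivided₂ [ adj⇒≢ G vb ∘ sym , a≢b ∘ sym ]′)

    v₁c : adj S₁.K′ (suc v) (suc c) ≡ true
    v₁c = S₁.old–old vc (S₁.¬end⇒¬subdivided₂ [ adj⇒≢ G vc ∘ sym , a≢c ∘ sym ]′)

    module S₂ = SubdivisionOf S₁.K′ (suc v) (suc b) v₁b

    v₂c : adj S₂.K′ (suc (suc v)) (suc (suc c)) ≡ true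
    v₂c = S₂.old–old {suc v} {suc c} v₁c (S₂.¬end⇒¬subdivided₂
            [ adj⇒≢ G vc ∘ sym ∘ suc-injective , b≢c ∘ sym ∘ suc-injective ]′)

    module S₃ = SubdivisionOf S₂.K′ (suc (suc v)) (suc (suc c)) v₂c

    outerLeg : Vertex G → Fin 3
    outerLeg x with x ≟ a | x ≟ b
    ... | yes _ | _     = zero
    ... | no _  | yes _ = suc zero
    ... | no _  | no _  = suc (suc zero)

    outerLeg-a : outerLeg a ≡ zero
    outerLeg-a with a ≟ a
    ... | yes _  = refl
    ... | no a≢a = contradiction refl a≢a

    outerLeg-b : outerLeg b ≡ suc zero
    outerLeg-b with b ≟ a | b ≟ b
    ... | yes b≡a | _     = contradiction (sym b≡a) a≢b
    ... | no _    | yes _ = refl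
    ... | no _    | no b≢b = contradiction refl b≢b

    outerLeg-c : outerLeg c ≡ suc (suc zero)
    outerLeg-c with c ≟ a | c ≟ b
    ... | yes c≡a | _     = contradiction (sym c≡a) a≢c
    ... | no _    | yes c≡b = contradiction (sym c≡b) b≢c
    ... | no _    | no _  = refl

    -- In S₃.K′ the vertex of G named x is suc (suc (suc x)), and the vertices created by
    -- the three subdivisions are z₁ = suc (suc zero), z₂ = suc zero and z₃ = zero.
    v₃ : Vertex S₃.K′
    v₃ = suc (suc (suc v))

    v–z₁ : adj S₃.K′ v₃ (suc (suc zero)) ≡ true
    v–z₁ = S₃.old–old {suc (suc v)} {suc zero}
             (S₂.old–old {suc v} {zero} (S₁.end–new (inj₁ refl))
                                       (S₂.¬end⇒¬subdivided₂ λ { (inj₁ ()) ; (inj₂ ()) }))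
             (S₃.¬end⇒¬subdivided₂ λ { (inj₁ ()) ; (inj₂ ()) })

    z₁–a : adj S₃.K′ (suc (suc zero)) (suc (suc (suc a))) ≡ true
    z₁–a = S₃.old–old {suc zero} {suc (suc a)}
             (S₂.old–old {zero} {suc a} (S₁.new–end (inj₂ refl))
                                       (S₂.¬end⇒¬subdivided₁ λ { (inj₁ ()) ; (inj₂ ()) }))
             (S₃.¬end⇒¬subdivided₁ λ { (inj₁ ()) ; (inj₂ ()) })

    v–z₂ : adj S₃.K′ v₃ (suc zero) ≡ true
    v–z₂ = S₃.old–old {suc (suc v)} {zero} (S₂.end–new (inj₁ refl))
             (S₃.¬end⇒¬subdivided₂ λ { (inj₁ ()) ; (inj₂ ()) })

    z₂–b : adj S₃.K′ (suc zero) (suc (suc (suc b))) ≡ true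
    z₂–b = S₃.old–old {zero} {suc (suc b)} (S₂.new–end (inj₂ refl))
             (S₃.¬end⇒¬subdivided₁ λ { (inj₁ ()) ; (inj₂ ()) })

  claw⇒spider : Σ Graph λ H → Subdivision G H × Spider H
  claw⇒spider = S₃.K′ , step (step (step here v a va) (suc v) (suc b) v₁b) (suc (suc v)) (suc (suc c)) v₂c ,
    record
    { centre       = v₃
    ; inner        = λ { zero → suc (suc zero) ; (suc zero) → suc zero ; (suc (suc zero)) → zero }
    ; outer        = λ { zero → suc (suc (suc a)) ; (suc zero) → suc (suc (suc b))
                       ; (suc (suc zero)) → suc (suc (suc c)) }
    ; legOf        = λ { zero → suc (suc zero) ; (suc zero) → suc zero ; (suc (suc zero)) → zero
                       ; (suc (suc (suc x))) → outerLeg x }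
    ; centre–inner = λ { zero → v–z₁ ; (suc zero) → v–z₂ ; (suc (suc zero)) → S₃.end–new (inj₁ refl) }
    ; inner–outer  = λ { zero → z₁–a ; (suc zero) → z₂–b ; (suc (suc zero)) → S₃.new–end (inj₂ refl) }
    ; legOf-inner  = λ { zero → refl ; (suc zero) → refl ; (suc (suc zero)) → refl }
    ; legOf-outer  = λ { zero → outerLeg-a ; (suc zero) → outerLeg-b ; (suc (suc zero)) → outerLeg-c }
    ; centre≢outer = λ
      { zero             → adj⇒≢ G va ∘ suc-injective ∘ suc-injective ∘ suc-injective
      ; (suc zero)       → adj⇒≢ G vb ∘ suc-injective ∘ suc-injective ∘ suc-injective
      ; (suc (suc zero)) → adj⇒≢ G vc ∘ suc-injective ∘ suc-injective ∘ suc-injective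
      }
    }

-- Paths

module PathFromLeaf (G : Graph) (connected : ∀ x y → Reach G x y)
  (noClaw : ∀ x → ¬ ThreeNeighbours G x)
  (x₀ : Vertex G) (x₀-leaf : ∀ {y z} → adj G x₀ y ≡ true → adj G x₀ z ≡ true → y ≡ z) where

  Adjacent : Vertex G → Vertex G → Set
  Adjacent x y = adj G x y ≡ true

  record Walk (m : ℕ) : Set where
    field
      vertex   : ℕ → Vertex G
      starts   : vertex zero ≡ x₀
      steps    : Consecutive Adjacent m vertex
      distinct : Distinct m vertex

  module _ {m} (W : Walk m) where
    open Walk W

    Visited : Vertex G → Set
    Visited y = ∃ λ k → k < m × vertex k ≡ y

    visited? : Decidable Visited
    visited? y = ℕ.anyUpTo? (λ k → vertex k ≟ y) m

    vertex-injective : Injective _≡_ _≡_ (vertex ∘ toℕ {m})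
    vertex-injective eq = toℕ-injective (distinct (toℕ<n _) (toℕ<n _) eq)

    walk-bounded : m ≤ n G
    walk-bounded = injective⇒≤ vertex-injective

    cover-bounded : (∀ y → Visited y) → n G ≤ m
    cover-bounded cover = injective⇒≤ {f = index} index-injective
      where
      index : Vertex G → Fin m
      index y = fromℕ< (proj₁ (proj₂ (cover y)))
      index-injective : Injective _≡_ _≡_ index
      index-injective {y} {z} eq with cover y | cover z | toℕ-fromℕ< (proj₁ (proj₂ (cover y)))
                                      | toℕ-fromℕ< (proj₁ (proj₂ (cover z)))
      ... | k , _ , refl | l , _ , refl | toℕ≡k | toℕ≡l =
        cong vertex (trans (sym toℕ≡k) (trans (cong toℕ eq) toℕ≡l))

    -- Away from the last vertex, maximum degree two leaves no room for other neighbours.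
    inner-neighbours : ∀ {k z} → suc k < m → Adjacent (vertex k) z →
                       z ≡ vertex (suc k) ⊎ ∃ λ j → k ≡ suc j × z ≡ vertex j
    inner-neighbours {zero} 1<m x₀z =
      inj₁ (x₀-leaf (subst (λ x → Adjacent x _) starts x₀z)
                    (subst (λ x → Adjacent x _) starts (steps 0 1<m)))
    inner-neighbours {suc j} {z} 2+j<m jz with z ≟ vertex j | z ≟ vertex (suc (suc j))
    ... | yes z≡j | _       = inj₂ (j , refl , z≡j)
    ... | no _    | yes z≡2+j = inj₁ z≡2+j
    ... | no z≢j  | no z≢2+j = contradiction
      (vertex j , vertex (suc (suc j)) , z , adj-sym G (steps j (ℕ.<-trans (ℕ.n<1+n _) 2+j<m)) ,
       steps (suc j) 2+j<m , jz , j≢2+j , z≢j ∘ sym , z≢2+j ∘ sym)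
      (noClaw (vertex (suc j)))
      where
      j≢2+j : vertex j ≢ vertex (suc (suc j))
      j≢2+j eq = ℕ.<⇒≢ (ℕ.m<n⇒m<1+n (ℕ.n<1+n j))
                   (distinct (ℕ.<-trans (ℕ.<-trans (ℕ.n<1+n j) (ℕ.n<1+n _)) 2+j<m) 2+j<m eq)

    non-adjacent< : ∀ {k l} → k < l → l < m → suc k ≢ l → ¬ Adjacent (vertex k) (vertex l)
    non-adjacent< {k} {l} k<l l<m 1+k≢l kl with inner-neighbours (ℕ.≤-<-trans k<l l<m) kl
    ... | inj₁ l≡1+k          = 1+k≢l (sym (distinct l<m (ℕ.≤-<-trans k<l l<m) l≡1+k))
    ... | inj₂ (j , refl , l≡j) =
      ℕ.<-irrefl (sym (distinct l<m (ℕ.<-trans (ℕ.n<1+n j) (ℕ.<-trans k<l l<m)) l≡j))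
                 (ℕ.<-trans (ℕ.n<1+n j) k<l)

    adjacency : ∀ {k l} → k < m → l < m →
                adj G (vertex k) (vertex l) ≡ (⌊ suc k ℕ.≟ l ⌋ ∨ ⌊ suc l ℕ.≟ k ⌋)
    adjacency {k} {l} k<m l<m with suc k ℕ.≟ l | suc l ℕ.≟ k
    ... | yes refl | _        = steps k l<m
    ... | no _     | yes refl = adj-sym G (steps l k<m)
    ... | no 1+k≢l | no 1+l≢k with ℕ.<-cmp k l
    ...   | tri< k<l _ _   = ¬-not (non-adjacent< k<l l<m 1+k≢l)
    ...   | tri≈ _ refl _  = ¬-not λ kk → adj⇒≢ G kk refl
    ...   | tri> _ _ l<k   = ¬-not (non-adjacent< l<k k<m 1+l≢k ∘ adj-sym G)

  reach-visited : ∀ {m} (W : Walk m) → (∀ {y z} → Visited W y → Adjacent y z → Visited W z) →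
                  ∀ {x y} → Reach G x y → Visited W x → Visited W y
  reach-visited W closed reach-refl          = id
  reach-visited W closed (reach-step xy reach) = reach-visited W closed reach ∘ flip closed xy

  module _ {i} (W : Walk (suc i)) where
    open Walk W

    stuck⇒closed : ¬ (∃ λ r → Adjacent (vertex i) r × ¬ Visited W r) →
                   ∀ {y z} → Visited W y → Adjacent y z → Visited W z
    stuck⇒closed stuck {z = z} (k , k<1+i , refl) yz with ℕ.m<1+n⇒m<n∨m≡n k<1+i
    ... | inj₂ refl = decidable-stable (visited? W z) λ z∉ → stuck (z , yz , z∉)
    ... | inj₁ k<i with inner-neighbours W (s≤s k<i) yz
    ...   | inj₁ z≡1+k          = suc k , s≤s k<i , sym z≡1+k
    ...   | inj₂ (j , refl , z≡j) = j , ℕ.<-trans (ℕ.n<1+n j) k<1+i , sym z≡j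

  extend-or-cover : ∀ {m} (W : Walk m) → Walk (suc m) ⊎ (∀ y → Visited W y)
  extend-or-cover {zero} W = inj₁ record
    { vertex   = λ _ → x₀
    ; starts   = refl
    ; steps    = λ _ → λ { (s≤s ()) }
    ; distinct = λ { (s≤s z≤n) (s≤s z≤n) _ → refl }
    }
  extend-or-cover {suc i} W
    with any? (λ r → (adj G (Walk.vertex W i) r Bool.≟ true) ×-dec ¬? (visited? W r))
  ... | yes (r , ir , r∉) = inj₁ record
    { vertex   = extend vertex i r
    ; starts   = trans (extend-< vertex {i} r (s≤s z≤n)) starts
    ; steps    = extend-consecutive vertex r Adjacent steps ir
    ; distinct = extend-distinct vertex r distinct λ k< eq → r∉ (_ , k< , eq)
    }
    where open Walk W
  ... | no stuck = inj₂ λ y →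
    reach-visited W (stuck⇒closed W stuck) (connected x₀ y) (0 , s≤s z≤n , Walk.starts W)

  walk : ∀ m → m ≤ n G → Walk m
  walk zero    _     = record { vertex = λ _ → x₀ ; starts = refl ; steps = λ _ () ; distinct = λ () }
  walk (suc m) m<n =
    [ id , (λ cover → contradiction (cover-bounded W cover) (ℕ.<⇒≱ m<n)) ]′ (extend-or-cover W)
    where W = walk m (ℕ.<⇒≤ m<n)

  isPath : IsPath G
  isPath = vertex ∘ toℕ , (vertex-injective W , surjective) , λ i j → adjacency W (toℕ<n i) (toℕ<n j)
    where
    W = walk (n G) ℕ.≤-refl
    open Walk W
    covered : ∀ y → Visited W y
    covered = [ (λ W′ → contradiction (walk-bounded W′) ℕ.1+n≰n) , id ]′ (extend-or-cover W)
    surjective : ∀ y → ∃ λ j → ∀ {j′} → j′ ≡ j → vertex (toℕ j′) ≡ y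
    surjective y = let k , k<n , k↦y = covered y in
      fromℕ< k<n , λ { refl → trans (cong vertex (toℕ-fromℕ< k<n)) k↦y }

¬TwoNeighbours⇒leaf : ∀ K {x} → ¬ TwoNeighbours K x →
                      ∀ {y z} → adj K x y ≡ true → adj K x z ≡ true → y ≡ z
¬TwoNeighbours⇒leaf K ¬two {y} {z} xy xz = decidable-stable (y ≟ z) λ y≢z → ¬two (y , z , xy , xz , y≢z)

proposition5p5 : (G : Graph) → Connected G → TopInspectionAtMost G 2 → IsPath G
proposition5p5 G (1≤n , connected) top with any? (threeNeighbours? G)
... | yes (v , a , b , c , va , vb , vc , a≢b , a≢c , b≢c) =
  let H , G⇝H , spiderH = claw⇒spider va vb vc a≢b a≢c b≢c
      H′ , H⇝H′ , in[H′]≤2 = top H G⇝H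
      spiderH′ = subdivision-preserves Spider (λ {K} {u} {w} → SubdivisionOf.liftSpider K u w) H⇝H′ spiderH
  in ⊥-elim (spider⇒¬InspectionAtMost2 spiderH′ in[H′]≤2)
... | no claw-free with all? (twoNeighbours? G)
...   | yes δ =
  let H′ , G⇝H′ , in[H′]≤2 = top G here
      x′ = subdivision-preserves Vertex (λ _ → suc) G⇝H′ (fromℕ< 1≤n)
      δ′ = subdivision-preserves MinDegree≥2 (λ {K} {u} {w} → SubdivisionOf.minDegree≥2 K u w) G⇝H′ δ
  in ⊥-elim (minDegree≥2⇒¬InspectionAtMost2 H′ x′ δ′ in[H′]≤2)
...   | no ¬δ =
  let x₀ , ¬two = ¬∀⟶∃¬ _ _ (twoNeighbours? G) ¬δ
  in PathFromLeaf.isPath G connected (λ x → claw-free ∘ (x ,_)) x₀ (¬TwoNeighbours⇒leaf G ¬two)
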